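{- Let $\Gamma$ be a graph, let $G \leq \mathrm{Aut}(\Gamma)$, and let $\alpha$ be a $G$-consistent walk. Then $\alpha$ has Property (R) with respect to $G$ if and only if the group $\langle \mathrm{Sh}_G(\alpha) \rangle$ generated by all shunts of $\alpha$ lying in $G$ acts transitively on $V(\Gamma)$.
   Context: All graphs are finite and simple with at least three vertices. Automorphisms act on the right, $x \mapsto x^g$, and act on tuples of vertices coordinatewise. A walk of length $n \geq 1$ is a tuple $(v_0, \ldots, v_n)$ of vertices in which any two consecutive vertices are adjacent. For $G \leq \mathrm{Aut}(\Gamma)$, a walk $\alpha = (v_0, \ldots, v_n)$ is $G$-consistent if there exists $g \in G$ (called a shunt of $\alpha$) such that $v_i^g = v_{i+1}$ for all $i \in \{0, \ldots, n-1\}$; $\mathrm{Sh}_G(\alpha)$ denotes the set of all shunts of $\alpha$ in $G$. For a $G$-consistent walk $\alpha = (v_0, \ldots, v_n)$, a walk $\beta = (v_1, \ldots, v_n, v_{n+1})$ is a $G$-successor of $\alpha$ if there is $g \in \mathrm{Sh}_G(\alpha)$ with $v_n^g = v_{n+1}$; $\mathrm{Succ}_G(\alpha)$ denotes the set of $G$-successors of $\alpha$. A $G$-consistent walk $\alpha$ has Property (R) with respect to $G$ if for every vertex $v \in V(\Gamma)$ there exists a sequence of walks $\beta_0, \ldots, \beta_m$ with $\beta_0 = \alpha$, $\beta_{i+1} \in \mathrm{Succ}_G(\beta_i)$ for all $i \in \{0, \ldots, m-1\}$, and the last vertex of $\beta_m$ equal to $v$. -}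

module Defs where

open import Level using (0ℓ)
open import Data.Nat using (ℕ; suc; _≤_)
open import Data.Fin using (Fin; inject₁) renaming (suc to fsuc)
open import Data.Fin.Permutation
  using (Permutation′; _⟨$⟩ʳ_; _≈_; id; flip; _∘ₚ_)
open import Data.Vec using (Vec; lookup; last; tail; _∷ʳ_)
open import Data.Product using (Σ; ∃; _×_)
open import Data.Empty using (⊥)
open import Relation.Binary.PropositionalEquality using (_≡_)
open import Relation.Binary.Construct.Closure.ReflexiveTransitive using (Star)

record Graph (N : ℕ) : Set₁ where
  field
    Adj      : Fin N → Fin N → Set
    symmetric   : ∀ {x y} → Adj x y → Adj y x
    irreflexive : ∀ {x} → Adj x x → ⊥
open Graph public

-- Right action: x ^ g.  Note g ∘ₚ h means "first g, then h", so
-- x ^ (g ∘ₚ h) ≡ (x ^ g) ^ h.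
_^_ : ∀ {N} → Fin N → Permutation′ N → Fin N
x ^ g = g ⟨$⟩ʳ x

IsAut : ∀ {N} → Graph N → Permutation′ N → Set
IsAut Γ g = ∀ x y → (Adj Γ x y → Adj Γ (x ^ g) (y ^ g)) × (Adj Γ (x ^ g) (y ^ g) → Adj Γ x y)

record SubgroupAut {N : ℕ} (Γ : Graph N) : Set₁ where
  field
    _∈G    : Permutation′ N → Set
    ∈G-resp : ∀ {g h} → g ≈ h → g ∈G → h ∈G
    ∈G-aut  : ∀ {g} → g ∈G → IsAut Γ g
    ∈G-id   : id ∈G
    ∈G-mul  : ∀ {g h} → g ∈G → h ∈G → (g ∘ₚ h) ∈G
    ∈G-inv  : ∀ {g} → g ∈G → flip g ∈G
open SubgroupAut public

IsWalk : ∀ {N n} → Graph N → Vec (Fin N) (suc n) → Set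
IsWalk {n = n} Γ α = ∀ (i : Fin n) → Adj Γ (lookup α (inject₁ i)) (lookup α (fsuc i))

IsShunt : ∀ {N n} {Γ : Graph N} → SubgroupAut Γ → Vec (Fin N) (suc n) → Permutation′ N → Set
IsShunt {n = n} G α g = SubgroupAut._∈G G g × (∀ (i : Fin n) → lookup α (inject₁ i) ^ g ≡ lookup α (fsuc i))

Consistent : ∀ {N n} {Γ : Graph N} → SubgroupAut Γ → Vec (Fin N) (suc n) → Set
Consistent G α = ∃ λ g → IsShunt G α g

Succ : ∀ {N n} {Γ : Graph N} → SubgroupAut Γ → Vec (Fin N) (suc n) → Vec (Fin N) (suc n) → Set
Succ G α β = ∃ λ g → IsShunt G α g × (β ≡ tail α ∷ʳ (last α ^ g))

PropertyR : ∀ {N n} {Γ : Graph N} → SubgroupAut Γ → Vec (Fin N) (suc n) → Set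
PropertyR {N} G α = ∀ (v : Fin N) → ∃ λ β → Star (Succ G) α β × (last β ≡ v)

data ⟨_⟩ {N : ℕ} (S : Permutation′ N → Set) : Permutation′ N → Set where
  gen  : ∀ {g} → S g → ⟨ S ⟩ g
  one  : ⟨ S ⟩ id
  mul  : ∀ {g h} → ⟨ S ⟩ g → ⟨ S ⟩ h → ⟨ S ⟩ (g ∘ₚ h)
  inv  : ∀ {g} → ⟨ S ⟩ g → ⟨ S ⟩ (flip g)
  resp : ∀ {g h} → g ≈ h → ⟨ S ⟩ g → ⟨ S ⟩ h

Transitive : ∀ {N} → (Permutation′ N → Set) → Set
Transitive {N} H = ∀ (u v : Fin N) → ∃ λ g → H g × (u ^ g ≡ v)

{-# OPTIONS --safe #-}
-- The walks reachable from α are exactly the images α^h with h ∈ H = ⟨Sh(α)⟩.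
-- Since Sh(α^h) = h⁻¹ Sh(α) h, a successor of α^h is α^(hg) with hg ∈ H.
-- Conversely, from α^m one reaches α^(sm) for every shunt s of α, so the p with
-- "α^m reachable ⇒ α^(pm) reachable" form a submonoid containing Sh(α); in a finite
-- permutation group a submonoid is a subgroup (g⁻¹ is a power of g), so it contains H.
-- Hence Property (R) says that the H-orbit of the last vertex of α is all of V(Γ),
-- which is transitivity of H.
module Submission where

open import Defs
open import Data.Nat using (ℕ; zero; suc; _+_; _*_; _≤_)
open import Data.Nat.Properties using (+-suc; *-comm; m≤n⇒∃[o]m+o≡n; n<1+n)
open import Data.Fin using (Fin; inject₁; toℕ) renaming (suc to fsuc; zero to fzero)
open import Data.Fin.Properties using (pigeonhole)
open import Data.Fin.Permutation
  using (Permutation′; _⟨$⟩ʳ_; _⟨$⟩ˡ_; inverseˡ; inverseʳ; _≈_; id; flip; _∘ₚ_)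
open import Data.Vec using (Vec; lookup; last; tail; _∷ʳ_; map; _∷_; [])
open import Data.Vec.Properties using (lookup-map; map-∘; map-cong; map-id)
open import Data.List using (List; allFin) renaming (_∷_ to _∷ₗ_; [] to []ₗ)
open import Data.List.Relation.Unary.All as All using (All) renaming (_∷_ to _∷ₐ_; [] to []ₐ)
open import Data.List.Membership.Propositional.Properties using (∈-allFin)
open import Data.Product using (∃; _×_; _,_; proj₁; proj₂)
open import Function.Bundles using (_⇔_; mk⇔)
import Function.Properties.Equivalence as ⇔
open import Relation.Binary.PropositionalEquality
  using (_≡_; refl; sym; trans; cong; cong₂; subst; module ≡-Reasoning)
open import Relation.Binary.Construct.Closure.ReflexiveTransitive using (Star; ε; _◅_; _◅◅_)

last-map : ∀ {A B : Set} {n} (f : A → B) (xs : Vec A (suc n)) → last (map f xs) ≡ f (last xs)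
last-map {n = zero}  f (x ∷ [])     = refl
last-map {n = suc n} f (x ∷ y ∷ ys) = last-map f (y ∷ ys)

tail-∷ʳ-shift : ∀ {A : Set} {n} (f : A → A) (xs : Vec A (suc n)) →
                (∀ (i : Fin n) → f (lookup xs (inject₁ i)) ≡ lookup xs (fsuc i)) →
                tail xs ∷ʳ f (last xs) ≡ map f xs
tail-∷ʳ-shift {n = zero}  f (x ∷ [])     shifts = refl
tail-∷ʳ-shift {n = suc n} f (x ∷ y ∷ ys) shifts =
  cong₂ _∷_ (sym (shifts fzero)) (tail-∷ʳ-shift f (y ∷ ys) (λ i → shifts (fsuc i)))

module _ {N : ℕ} where

  ^-injective : ∀ (g : Permutation′ N) {x y} → x ^ g ≡ y ^ g → x ≡ y
  ^-injective g e = trans (sym (inverseˡ g)) (trans (cong (g ⟨$⟩ˡ_) e) (inverseˡ g))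

  pow : Permutation′ N → ℕ → Permutation′ N
  pow g zero    = id
  pow g (suc k) = pow g k ∘ₚ g

  ^-pow-suc : ∀ g k (y : Fin N) → y ^ pow g (suc k) ≡ (y ^ g) ^ pow g k
  ^-pow-suc g zero    y = refl
  ^-pow-suc g (suc k) y = cong (_^ g) (^-pow-suc g k y)

  ^-pow-+ : ∀ g a b (y : Fin N) → y ^ pow g (a + b) ≡ (y ^ pow g b) ^ pow g a
  ^-pow-+ g zero    b y = refl
  ^-pow-+ g (suc a) b y = cong (_^ g) (^-pow-+ g a b y)

  ^-pow-* : ∀ g p (y : Fin N) → y ^ pow g p ≡ y → ∀ b → y ^ pow g (b * p) ≡ y
  ^-pow-* g p y fix zero    = refl
  ^-pow-* g p y fix (suc b) = begin
    y ^ pow g (p + b * p)        ≡⟨ ^-pow-+ g p (b * p) y ⟩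
    (y ^ pow g (b * p)) ^ pow g p ≡⟨ cong (_^ pow g p) (^-pow-* g p y fix b) ⟩
    y ^ pow g p                  ≡⟨ fix ⟩
    y                            ∎
    where open ≡-Reasoning

  -- Pigeonhole on y, y^g, …, y^(g^N): two of them coincide, and g^i can be cancelled.
  ^-pow-period : ∀ g (y : Fin N) → ∃ λ k → y ^ pow g (suc k) ≡ y
  ^-pow-period g y with i , j , i<j , e ← pigeonhole (n<1+n N) (λ (i : Fin (suc N)) → y ^ pow g (toℕ i))
                   with d , i+d≡j ← m≤n⇒∃[o]m+o≡n i<j =
    d , ^-injective (pow g (toℕ i)) (begin
      (y ^ pow g (suc d)) ^ pow g (toℕ i) ≡⟨ ^-pow-+ g (toℕ i) (suc d) y ⟨
      y ^ pow g (toℕ i + suc d)           ≡⟨ cong (λ t → y ^ pow g t) (trans (+-suc (toℕ i) d) i+d≡j) ⟩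
      y ^ pow g (toℕ j)                   ≡⟨ e ⟨
      y ^ pow g (toℕ i)                   ∎)
    where open ≡-Reasoning

  pow-period-all : ∀ g (ys : List (Fin N)) → ∃ λ k → All (λ y → y ^ pow g (suc k) ≡ y) ys
  pow-period-all g []ₗ        = zero , []ₐ
  pow-period-all g (y ∷ₗ ys) with k , fixy ← ^-pow-period g y | l , fixys ← pow-period-all g ys =
    l + k * suc l ,
    subst (λ t → y ^ pow g t ≡ y) (*-comm (suc l) (suc k)) (^-pow-* g (suc k) y fixy (suc l)) ∷ₐ
    All.map (λ {z} fixz → ^-pow-* g (suc l) z fixz (suc k)) fixys

  pow-period : ∀ g → ∃ λ k → pow g (suc k) ≈ id
  pow-period g with k , fixes ← pow-period-all g (allFin N) = k , λ y → All.lookup fixes (∈-allFin y)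

  flip≈pow : ∀ g → ∃ λ k → flip g ≈ pow g k
  flip≈pow g with k , period ← pow-period g = k , λ z → begin
    z ^ flip g                      ≡⟨ period (z ^ flip g) ⟨
    (z ^ flip g) ^ pow g (suc k)    ≡⟨ ^-pow-suc g k (z ^ flip g) ⟩
    ((z ^ flip g) ^ g) ^ pow g k    ≡⟨ cong (_^ pow g k) (inverseʳ g) ⟩
    z ^ pow g k                     ∎
    where open ≡-Reasoning

  record IsSubmonoid (P : Permutation′ N → Set) : Set where
    field
      ≈-closed  : ∀ {g h} → g ≈ h → P g → P h
      id-closed : P id
      ∘-closed  : ∀ {g h} → P g → P h → P (g ∘ₚ h)

  module _ {P : Permutation′ N → Set} (isSubmonoid : IsSubmonoid P) where
    open IsSubmonoid isSubmonoid

    pow∈ : ∀ {g} → P g → ∀ k → P (pow g k)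
    pow∈ g∈ zero    = id-closed
    pow∈ g∈ (suc k) = ∘-closed (pow∈ g∈ k) g∈

    flip∈ : ∀ {g} → P g → P (flip g)
    flip∈ {g} g∈ with k , flip≈ ← flip≈pow g = ≈-closed (λ z → sym (flip≈ z)) (pow∈ g∈ k)

    ⟨⟩⊆ : ∀ {S : Permutation′ N → Set} → (∀ {g} → S g → P g) → ∀ {g} → ⟨ S ⟩ g → P g
    ⟨⟩⊆ S⊆P (gen s)      = S⊆P s
    ⟨⟩⊆ S⊆P one          = id-closed
    ⟨⟩⊆ S⊆P (mul g∈ h∈)  = ∘-closed (⟨⟩⊆ S⊆P g∈) (⟨⟩⊆ S⊆P h∈)
    ⟨⟩⊆ S⊆P (inv g∈)     = flip∈ (⟨⟩⊆ S⊆P g∈)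
    ⟨⟩⊆ S⊆P (resp g≈ g∈) = ≈-closed g≈ (⟨⟩⊆ S⊆P g∈)

  Orbit : (Permutation′ N → Set) → Fin N → Fin N → Set
  Orbit H u v = ∃ λ g → H g × u ^ g ≡ v

  transitive⇔orbit-full : ∀ {S : Permutation′ N → Set} (x : Fin N) →
                          Transitive ⟨ S ⟩ ⇔ (∀ v → Orbit ⟨ S ⟩ x v)
  transitive⇔orbit-full {S} x = mk⇔ (λ transitive v → transitive x v) from-orbit
    where
    from-orbit : (∀ v → Orbit ⟨ S ⟩ x v) → Transitive ⟨ S ⟩
    from-orbit orbit u v with g , g∈ , xg≡u ← orbit u | h , h∈ , xh≡v ← orbit v =
      flip g ∘ₚ h , mul (inv g∈) h∈ , (begin
        (u ^ flip g) ^ h        ≡⟨ cong (λ w → (w ^ flip g) ^ h) xg≡u ⟨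
        ((x ^ g) ^ flip g) ^ h  ≡⟨ cong (_^ h) (inverseˡ g) ⟩
        x ^ h                   ≡⟨ xh≡v ⟩
        v                       ∎)
      where open ≡-Reasoning

  _^ᵛ_ : ∀ {m} → Vec (Fin N) m → Permutation′ N → Vec (Fin N) m
  β ^ᵛ g = map (_^ g) β

  ^ᵛ-id : ∀ {m} (β : Vec (Fin N) m) → β ^ᵛ id ≡ β
  ^ᵛ-id β = map-id β

  ^ᵛ-∘ : ∀ {m} (β : Vec (Fin N) m) g h → β ^ᵛ (g ∘ₚ h) ≡ (β ^ᵛ g) ^ᵛ h
  ^ᵛ-∘ β g h = map-∘ (_^ h) (_^ g) β

  ^ᵛ-cong : ∀ {m} (β : Vec (Fin N) m) {g h} → g ≈ h → β ^ᵛ g ≡ β ^ᵛ h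
  ^ᵛ-cong β g≈h = map-cong g≈h β

module _ {N n : ℕ} {Γ : Graph N} (G : SubgroupAut Γ) where

  ∈G-isSubmonoid : IsSubmonoid (_∈G G)
  ∈G-isSubmonoid = record { ≈-closed = ∈G-resp G ; id-closed = ∈G-id G ; ∘-closed = ∈G-mul G }

  module _ (β : Vec (Fin N) (suc n)) {h : Permutation′ N} (h∈ : _∈G G h) where

    shunt-^ᵛ⇒conj : ∀ {g} → IsShunt G (β ^ᵛ h) g → IsShunt G β (h ∘ₚ g ∘ₚ flip h)
    shunt-^ᵛ⇒conj {g} (g∈ , shifts) = ∈G-mul G h∈ (∈G-mul G g∈ (∈G-inv G h∈)) , λ i → begin
      ((lookup β (inject₁ i) ^ h) ^ g) ^ flip h ≡⟨ cong (λ w → (w ^ g) ^ flip h) (lookup-map (inject₁ i) (_^ h) β) ⟨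
      (lookup (β ^ᵛ h) (inject₁ i) ^ g) ^ flip h ≡⟨ cong (_^ flip h) (shifts i) ⟩
      lookup (β ^ᵛ h) (fsuc i) ^ flip h         ≡⟨ cong (_^ flip h) (lookup-map (fsuc i) (_^ h) β) ⟩
      (lookup β (fsuc i) ^ h) ^ flip h          ≡⟨ inverseˡ h ⟩
      lookup β (fsuc i)                         ∎
      where open ≡-Reasoning

    shunt⇒conj-^ᵛ : ∀ {s} → IsShunt G β s → IsShunt G (β ^ᵛ h) (flip h ∘ₚ s ∘ₚ h)
    shunt⇒conj-^ᵛ {s} (s∈ , shifts) = ∈G-mul G (∈G-inv G h∈) (∈G-mul G s∈ h∈) , λ i → begin
      ((lookup (β ^ᵛ h) (inject₁ i) ^ flip h) ^ s) ^ h ≡⟨ cong (λ w → ((w ^ flip h) ^ s) ^ h) (lookup-map (inject₁ i) (_^ h) β) ⟩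
      (((lookup β (inject₁ i) ^ h) ^ flip h) ^ s) ^ h ≡⟨ cong (λ w → (w ^ s) ^ h) (inverseˡ h) ⟩
      (lookup β (inject₁ i) ^ s) ^ h                  ≡⟨ cong (_^ h) (shifts i) ⟩
      lookup β (fsuc i) ^ h                           ≡⟨ lookup-map (fsuc i) (_^ h) β ⟨
      lookup (β ^ᵛ h) (fsuc i)                        ∎
      where open ≡-Reasoning

  succ-≡-^ᵛ : ∀ (β : Vec (Fin N) (suc n)) {g} → IsShunt G β g → tail β ∷ʳ (last β ^ g) ≡ β ^ᵛ g
  succ-≡-^ᵛ β {g} (_ , shifts) = tail-∷ʳ-shift (_^ g) β shifts

  module _ (α : Vec (Fin N) (suc n)) where

    H : Permutation′ N → Set
    H = ⟨ IsShunt G α ⟩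

    H⊆G : ∀ {h} → H h → _∈G G h
    H⊆G = ⟨⟩⊆ ∈G-isSubmonoid proj₁

    Reachable : Vec (Fin N) (suc n) → Set
    Reachable = Star (Succ G) α

    ImageOfα : Vec (Fin N) (suc n) → Set
    ImageOfα β = ∃ λ h → H h × β ≡ α ^ᵛ h

    ImageOfα-succ : ∀ {β γ} → ImageOfα β → Succ G β γ → ImageOfα γ
    ImageOfα-succ (h , h∈ , refl) (g , g-shunt , refl) =
      h ∘ₚ g , mul h∈ g∈H , trans (succ-≡-^ᵛ (α ^ᵛ h) g-shunt) (sym (^ᵛ-∘ α h g))
      where
      g≈ : flip h ∘ₚ (h ∘ₚ g ∘ₚ flip h) ∘ₚ h ≈ g
      g≈ x = trans (inverseʳ h) (cong (g ⟨$⟩ʳ_) (inverseʳ h))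
      g∈H : H g
      g∈H = resp g≈ (mul (inv h∈) (mul (gen (shunt-^ᵛ⇒conj α (H⊆G h∈) g-shunt)) h∈))

    ImageOfα-star : ∀ {β γ} → ImageOfα β → Star (Succ G) β γ → ImageOfα γ
    ImageOfα-star im ε        = im
    ImageOfα-star im (s ◅ ss) = ImageOfα-star (ImageOfα-succ im s) ss

    reachable⇒ImageOfα : ∀ {β} → Reachable β → ImageOfα β
    reachable⇒ImageOfα = ImageOfα-star (id , one , sym (^ᵛ-id α))

    Reached : Permutation′ N → Set
    Reached m = _∈G G m × Reachable (α ^ᵛ m)

    Reached-resp : ∀ {m m′} → m ≈ m′ → Reached m → Reached m′
    Reached-resp {m} {m′} m≈ (m∈ , r) = ∈G-resp G m≈ m∈ , subst Reachable (^ᵛ-cong α {m} {m′} m≈) r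

    PreservesReached : Permutation′ N → Set
    PreservesReached p = ∀ {m} → Reached m → Reached (p ∘ₚ m)

    PreservesReached-isSubmonoid : IsSubmonoid PreservesReached
    PreservesReached-isSubmonoid = record
      { ≈-closed  = λ p≈q pres {m} r → Reached-resp (λ x → cong (m ⟨$⟩ʳ_) (p≈q x)) (pres r)
      ; id-closed = Reached-resp (λ _ → refl)
      ; ∘-closed  = λ pres₁ pres₂ r → Reached-resp (λ _ → refl) (pres₁ (pres₂ r))
      }

    shunt-preservesReached : ∀ {s} → IsShunt G α s → PreservesReached s
    shunt-preservesReached {s} s-shunt {m} (m∈ , r) = ∈G-mul G (proj₁ s-shunt) m∈ , r ◅◅ (succ ◅ ε)
      where
      conj-shunt : IsShunt G (α ^ᵛ m) (flip m ∘ₚ s ∘ₚ m)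
      conj-shunt = shunt⇒conj-^ᵛ α m∈ s-shunt
      succ : Succ G (α ^ᵛ m) (α ^ᵛ (s ∘ₚ m))
      succ = flip m ∘ₚ s ∘ₚ m , conj-shunt , (begin
        α ^ᵛ (s ∘ₚ m)                                        ≡⟨ ^ᵛ-cong α {m ∘ₚ flip m ∘ₚ s ∘ₚ m} {s ∘ₚ m} (λ x → cong (λ w → (w ^ s) ^ m) (inverseˡ m)) ⟨
        α ^ᵛ (m ∘ₚ flip m ∘ₚ s ∘ₚ m)                          ≡⟨ ^ᵛ-∘ α m (flip m ∘ₚ s ∘ₚ m) ⟩
        (α ^ᵛ m) ^ᵛ (flip m ∘ₚ s ∘ₚ m)                        ≡⟨ succ-≡-^ᵛ (α ^ᵛ m) conj-shunt ⟨
        tail (α ^ᵛ m) ∷ʳ (last (α ^ᵛ m) ^ (flip m ∘ₚ s ∘ₚ m)) ∎)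
        where open ≡-Reasoning

    ImageOfα⇒reachable : ∀ {h} → H h → Reachable (α ^ᵛ h)
    ImageOfα⇒reachable h∈ =
      proj₂ (⟨⟩⊆ PreservesReached-isSubmonoid shunt-preservesReached h∈
                 (∈G-id G , subst Reachable (sym (^ᵛ-id α)) ε))

    PropertyR⇔orbit-full : PropertyR G α ⇔ (∀ v → Orbit H (last α) v)
    PropertyR⇔orbit-full = mk⇔ to from
      where
      to : PropertyR G α → ∀ v → Orbit H (last α) v
      to R v with β , r , last≡v ← R v
             with h , h∈ , refl ← reachable⇒ImageOfα r =
        h , h∈ , trans (sym (last-map (_^ h) α)) last≡v
      from : (∀ v → Orbit H (last α) v) → PropertyR G α
      from orbit v with h , h∈ , e ← orbit v =
        α ^ᵛ h , ImageOfα⇒reachable h∈ , trans (last-map (_^ h) α) e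

lemma3p4 : ∀ {N n : ℕ} → 3 ≤ N → 1 ≤ n → (Γ : Graph N) → (G : SubgroupAut Γ)
    → (α : Vec (Fin N) (suc n)) → IsWalk Γ α → Consistent G α
    → PropertyR G α ⇔ Transitive ⟨ IsShunt G α ⟩
lemma3p4 _ _ _ G α _ _ =
  ⇔.trans (PropertyR⇔orbit-full G α) (⇔.sym (transitive⇔orbit-full (last α)))
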